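{- Let $\lambda$ be a regular limit. (1) For any ordinal $\alpha$: $\lambda$ is $\beta$-complete for every $\beta<\alpha$ if and only if $\alpha\le\lambda$. (2) For any ordinal function $J$: $\lambda$ is $\gamma$-complete for every $\beta<\lambda$ and every $\gamma<J(\beta)$ if and only if $\lambda\ge J$.
   Context: Ambient theory: the Base Theory (intuitionistic set theory with urelements allowed and no Foundation, with Extensionality, Inhabitation, Empty Set, Pairing, Union, Replacement, Truth Value Separation, Infinity, Exponentiation; no Excluded Middle, Choice or Powerset). Ordinals: $\mathsf{Ord}$ is the least class such that every transitive set all of whose elements are in it belongs to it; $\alpha<\beta$ means $\alpha\in\beta$, $\alpha\le\beta$ means $\alpha\subseteq\beta$, $\alpha^+=\alpha\cup\{\alpha\}$. For a set $K$, $\lambda$ is $K$-complete if every function $K\to\lambda$ has union $<\lambda$. A limit is an ordinal $\lambda$ with $0<\lambda$, $\alpha<\lambda\Rightarrow\alpha^+<\lambda$, $\alpha,\beta<\lambda\Rightarrow\alpha\cup\beta<\lambda$. A limit $\lambda$ is regular if it is $\beta$-complete for every $\beta<\lambda$. An ordinal function is a class function $J:\mathsf{Ord}\to\mathsf{Ord}$ (not necessarily monotone); $\lambda\ge J$ means $J(\beta)\le\lambda$ for all $\beta<\lambda$. -}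

module Defs where

-- An abstract model of the Base Theory: intuitionistic set theory with
-- urelements allowed, no Foundation; axioms Extensionality, Inhabitation,
-- Empty Set, Pairing, Union, Replacement, Truth Value Separation, Infinity,
-- Exponentiation.
-- Existence axioms for Empty Set, Pairing, Union are given in Skolemised form
-- (operations with specifications); by Extensionality these are unique.

open import Data.Product using (Σ; _×_; _,_; proj₁; proj₂)
open import Data.Sum using (_⊎_)
open import Relation.Nullary using (¬_)
open import Relation.Binary.PropositionalEquality using (_≡_)

infix 2 _⟺_
_⟺_ : Set → Set → Set
A ⟺ B = (A → B) × (B → A)

record Structure : Set₁ where
  infix 4 _∈_
  field
    V      : Set
    _∈_    : V → V → Set
    -- sethood predicate (objects that are not sets are urelements)
    isSet  : V → Set
    members-set : ∀ {x y} → x ∈ y → isSet y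
    ext    : ∀ a b → isSet a → isSet b → (∀ x → (x ∈ a) ⟺ (x ∈ b)) → a ≡ b
    inhabitant : V
    ∅      : V
    ∅-set  : isSet ∅
    ∅-spec : ∀ x → ¬ (x ∈ ∅)
    pair      : V → V → V
    pair-set  : ∀ a b → isSet (pair a b)
    pair-spec : ∀ a b x → (x ∈ pair a b) ⟺ (x ≡ a ⊎ x ≡ b)
    ⋃      : V → V
    ⋃-set  : ∀ a → isSet (⋃ a)
    ⋃-spec : ∀ a x → (x ∈ ⋃ a) ⟺ Σ V (λ y → y ∈ a × x ∈ y)

module Derived (S : Structure) where
  open Structure S

  _⊆_ : V → V → Set
  a ⊆ b = ∀ x → x ∈ a → x ∈ b

  sing : V → V
  sing a = pair a a

  _∪_ : V → V → V
  a ∪ b = ⋃ (pair a b)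

  _⁺ : V → V
  a ⁺ = a ∪ sing a

  ⟨_,_⟩ : V → V → V
  ⟨ a , b ⟩ = pair (sing a) (pair a b)

  IsFunction : V → V → V → Set
  IsFunction f K L =
    isSet f
    × (∀ p → p ∈ f → Σ V (λ k → Σ V (λ l → k ∈ K × l ∈ L × p ≡ ⟨ k , l ⟩)))
    × (∀ k → k ∈ K → Σ V (λ l → ⟨ k , l ⟩ ∈ f × (∀ l' → ⟨ k , l' ⟩ ∈ f → l' ≡ l)))

  IsUnionOfValues : V → V → Set
  IsUnionOfValues f u =
    isSet u × (∀ x → (x ∈ u) ⟺ Σ V (λ k → Σ V (λ l → ⟨ k , l ⟩ ∈ f × x ∈ l)))

  data IsOrd (x : V) : Set where
    ord : isSet x
        → (∀ y z → z ∈ y → y ∈ x → z ∈ x)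
        → (∀ y → y ∈ x → IsOrd y)
        → IsOrd x

  Complete : V → V → Set
  Complete K Λ = ∀ f → IsFunction f K Λ → Σ V (λ u → IsUnionOfValues f u × u ∈ Λ)

  IsLimit : V → Set
  IsLimit Λ =
    IsOrd Λ
    × ∅ ∈ Λ
    × (∀ α → α ∈ Λ → (α ⁺) ∈ Λ)
    × (∀ α β → α ∈ Λ → β ∈ Λ → (α ∪ β) ∈ Λ)

  IsRegular : V → Set
  IsRegular Λ = IsLimit Λ × (∀ β → β ∈ Λ → Complete β Λ)

  record OrdinalFunction : Set where
    field
      J     : (α : V) → IsOrd α → V
      J-ord : ∀ α (o : IsOrd α) → IsOrd (J α o)
      J-irr : ∀ α (o o' : IsOrd α) → J α o ≡ J α o'

  _≥J_ : V → OrdinalFunction → Set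
  Λ ≥J F = ∀ β (o : IsOrd β) → β ∈ Λ → OrdinalFunction.J F β o ⊆ Λ

module _ (S : Structure) where
  open Structure S
  open Derived S

  record Axioms : Set₁ where
    field
      replacement : ∀ a (R : V → V → Set)
        → (∀ x → x ∈ a → Σ V (λ y → R x y × (∀ y' → R x y' → y' ≡ y)))
        → Σ V (λ b → isSet b × (∀ y → (y ∈ b) ⟺ Σ V (λ x → x ∈ a × R x y)))
      tv-separation : ∀ a (P : Set)
        → Σ V (λ b → isSet b × (∀ x → (x ∈ b) ⟺ (x ∈ a × P)))
      infinity : Σ V (λ I → isSet I × ∅ ∈ I × (∀ x → x ∈ I → (x ⁺) ∈ I))
      exponentiation : ∀ a b
        → Σ V (λ e → isSet e × (∀ f → (f ∈ e) ⟺ IsFunction f a b))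

record BaseTheory : Set₁ where
  field
    structure : Structure
    axioms    : Axioms structure

{-# OPTIONS --safe #-}
-- A successor-closed Λ that is β-complete contains every transitive set β ⊆ Λ:
-- the union of the function x ↦ x⁺ on β is β itself, so it lies below Λ.
-- By ∈-induction, completeness for all β < α then forces α ⊆ Λ; conversely
-- α ⊆ Λ gives completeness for all β < α by regularity. Part (2) is part (1)
-- applied to each J(β).
module Submission where

open import Defs
open import Data.Product using (_×_; Σ; _,_; proj₁; proj₂)
open import Data.Sum using (_⊎_; inj₁; inj₂; [_,_])
open import Function using (id)
open import Relation.Binary.PropositionalEquality
  using (_≡_; refl; sym; trans; subst)

module Pairs (S : Structure) where
  open Structure S
  open Derived S

  ∈-pairˡ : ∀ a b → a ∈ pair a b
  ∈-pairˡ a b = proj₂ (pair-spec a b a) (inj₁ refl)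

  ∈-pairʳ : ∀ a b → b ∈ pair a b
  ∈-pairʳ a b = proj₂ (pair-spec a b b) (inj₂ refl)

  ∈-pair⁻ : ∀ {a b x} → x ∈ pair a b → x ≡ a ⊎ x ≡ b
  ∈-pair⁻ {a} {b} {x} = proj₁ (pair-spec a b x)

  ∈-sing⁻ : ∀ {a x} → x ∈ sing a → x ≡ a
  ∈-sing⁻ x∈a = [ id , id ] (∈-pair⁻ x∈a)

  sing≡pair⇒≡ : ∀ {a b c} → sing a ≡ pair b c → a ≡ b
  sing≡pair⇒≡ {a} {b} {c} e = sym (∈-sing⁻ (subst (b ∈_) (sym e) (∈-pairˡ b c)))

  pair-injectiveʳ : ∀ {a b c} → pair a b ≡ pair a c → b ≡ c
  pair-injectiveʳ {a} {b} {c} e with ∈-pair⁻ (subst (b ∈_) e (∈-pairʳ a b))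
  ... | inj₂ b≡c = b≡c
  ... | inj₁ b≡a = [ (λ c≡a → trans b≡a (sym c≡a)) , sym ]
                     (∈-pair⁻ (subst (c ∈_) (sym e) (∈-pairʳ a c)))

  ⟨,⟩-injectiveˡ : ∀ {a b c d} → ⟨ a , b ⟩ ≡ ⟨ c , d ⟩ → a ≡ c
  ⟨,⟩-injectiveˡ {a} {b} {c} {d} e =
    [ sing≡pair⇒≡ , sing≡pair⇒≡ ]
      (∈-pair⁻ (subst (sing a ∈_) e (∈-pairˡ (sing a) (pair a b))))

  ⟨,⟩-injectiveʳ : ∀ {a b d} → ⟨ a , b ⟩ ≡ ⟨ a , d ⟩ → b ≡ d
  ⟨,⟩-injectiveʳ {a} {b} {d} e = pair-injectiveʳ ab≡ad
    where
    ab≡ad : pair a b ≡ pair a d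
    ab≡ad with ∈-pair⁻ (subst (pair a b ∈_) e (∈-pairʳ (sing a) (pair a b)))
    ... | inj₂ ab≡ad = ab≡ad
    ... | inj₁ ab≡aa with ∈-pair⁻ (subst (pair a d ∈_) (sym e) (∈-pairʳ (sing a) (pair a d)))
    ...   | inj₂ ad≡ab = sym ad≡ab
    ...   | inj₁ ad≡aa = trans ab≡aa (sym ad≡aa)

  ⟨,⟩-injective : ∀ {a b c d} → ⟨ a , b ⟩ ≡ ⟨ c , d ⟩ → a ≡ c × b ≡ d
  ⟨,⟩-injective {a} {b} e with ⟨,⟩-injectiveˡ e
  ... | refl = refl , ⟨,⟩-injectiveʳ e

  ∈-⁺ : ∀ a → a ∈ a ⁺
  ∈-⁺ a = proj₂ (⋃-spec (pair a (sing a)) a) (sing a , ∈-pairʳ a (sing a) , ∈-pairˡ a a)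

  ∈-⁺⁻ : ∀ {a x} → x ∈ a ⁺ → x ∈ a ⊎ x ≡ a
  ∈-⁺⁻ {a} {x} x∈a⁺ with proj₁ (⋃-spec (pair a (sing a)) x) x∈a⁺
  ... | y , y∈pair , x∈y = [ (λ y≡a → inj₁ (subst (x ∈_) y≡a x∈y))
                            , (λ y≡sa → inj₂ (∈-sing⁻ (subst (x ∈_) y≡sa x∈y))) ]
                            (∈-pair⁻ y∈pair)

  unionOfValues-unique : ∀ {f u u′} → IsUnionOfValues f u → IsUnionOfValues f u′ → u ≡ u′
  unionOfValues-unique {u = u} {u′} (u-set , u-spec) (u′-set , u′-spec) =
    ext u u′ u-set u′-set λ x → (λ x∈u → proj₂ (u′-spec x) (proj₁ (u-spec x) x∈u))
                              , (λ x∈u′ → proj₂ (u-spec x) (proj₁ (u′-spec x) x∈u′))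

module Completeness (T : BaseTheory) where
  open BaseTheory T
  open Structure structure
  open Derived structure
  open Axioms axioms
  open Pairs structure

  IsTransitiveSet : V → Set
  IsTransitiveSet β = isSet β × (∀ y z → z ∈ y → y ∈ β → z ∈ β)

  SucClosed : V → Set
  SucClosed Λ = ∀ α → α ∈ Λ → α ⁺ ∈ Λ

  private
    sucGraph-exists : ∀ β → Σ V λ g → isSet g × (∀ p → (p ∈ g) ⟺ Σ V λ x → x ∈ β × p ≡ ⟨ x , x ⁺ ⟩)
    sucGraph-exists β = replacement β (λ x p → p ≡ ⟨ x , x ⁺ ⟩) λ x _ → ⟨ x , x ⁺ ⟩ , refl , λ _ e → e

  sucGraph : V → V
  sucGraph β = proj₁ (sucGraph-exists β)

  sucGraph-spec : ∀ β p → (p ∈ sucGraph β) ⟺ Σ V λ x → x ∈ β × p ≡ ⟨ x , x ⁺ ⟩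
  sucGraph-spec β = proj₂ (proj₂ (sucGraph-exists β))

  ∈-sucGraph⁻ : ∀ {β k l} → ⟨ k , l ⟩ ∈ sucGraph β → k ∈ β × l ≡ k ⁺
  ∈-sucGraph⁻ {β} {k} {l} kl∈g with proj₁ (sucGraph-spec β _) kl∈g
  ... | x , x∈β , e with ⟨,⟩-injective e
  ...   | refl , l≡x⁺ = x∈β , l≡x⁺

  sucGraph-function : ∀ {β Λ} → SucClosed Λ → β ⊆ Λ → IsFunction (sucGraph β) β Λ
  sucGraph-function {β} {Λ} sucΛ β⊆Λ =
      proj₁ (proj₂ (sucGraph-exists β))
    , (λ p p∈g → let x , x∈β , e = proj₁ (sucGraph-spec β p) p∈g
                 in x , x ⁺ , x∈β , sucΛ x (β⊆Λ x x∈β) , e)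
    , λ k k∈β → k ⁺ , proj₂ (sucGraph-spec β _) (k , k∈β , refl)
              , λ l kl∈g → proj₂ (∈-sucGraph⁻ kl∈g)

  sucGraph-unionOfValues : ∀ {β} → IsTransitiveSet β → IsUnionOfValues (sucGraph β) β
  sucGraph-unionOfValues {β} (β-set , β-trans) = β-set , λ x → from x , to x
    where
    from : ∀ x → x ∈ β → Σ V λ k → Σ V λ l → ⟨ k , l ⟩ ∈ sucGraph β × x ∈ l
    from x x∈β = x , x ⁺ , proj₂ (sucGraph-spec β _) (x , x∈β , refl) , ∈-⁺ x
    to : ∀ x → (Σ V λ k → Σ V λ l → ⟨ k , l ⟩ ∈ sucGraph β × x ∈ l) → x ∈ β
    to x (k , l , kl∈g , x∈l) with ∈-sucGraph⁻ kl∈g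
    ... | k∈β , refl = [ (λ x∈k → β-trans k x x∈k k∈β) , (λ x≡k → subst (_∈ β) (sym x≡k) k∈β) ]
                         (∈-⁺⁻ x∈l)

  complete⇒∈ : ∀ {β Λ} → SucClosed Λ → IsTransitiveSet β → β ⊆ Λ → Complete β Λ → β ∈ Λ
  complete⇒∈ {Λ = Λ} sucΛ β-trans β⊆Λ complete =
    let u , u-union , u∈Λ = complete _ (sucGraph-function sucΛ β⊆Λ)
    in subst (_∈ Λ) (unionOfValues-unique u-union (sucGraph-unionOfValues β-trans)) u∈Λ

  completeBelow⇒⊆ : ∀ {α Λ} → SucClosed Λ → IsOrd α → (∀ β → β ∈ α → Complete β Λ) → α ⊆ Λ
  completeBelow⇒⊆ sucΛ (ord _ α-trans α-ord) complete β β∈α with α-ord β β∈α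
  ... | β-ord@(ord β-set β-trans _) =
    complete⇒∈ sucΛ (β-set , β-trans)
      (completeBelow⇒⊆ sucΛ β-ord λ γ γ∈β → complete γ (α-trans β γ γ∈β β∈α))
      (complete β β∈α)

proposition7p12 : (T : BaseTheory)
    → let open Structure (BaseTheory.structure T) in
    let open Derived (BaseTheory.structure T) in
    ∀ Λ → IsRegular Λ
    → (∀ α → IsOrd α → ((∀ β → β ∈ α → Complete β Λ) ⟺ (α ⊆ Λ)))
    × (∀ (F : OrdinalFunction)
    → ((∀ β (o : IsOrd β) → β ∈ Λ → ∀ γ → γ ∈ OrdinalFunction.J F β o → Complete γ Λ)
    ⟺ (Λ ≥J F)))
proposition7p12 T Λ ((_ , _ , sucΛ , _) , regular) =
    (λ α α-ord → completeBelow⇒⊆ sucΛ α-ord , λ α⊆Λ β β∈α → regular β (α⊆Λ β β∈α))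
  , λ F → (λ complete β β-ord β∈Λ →
              completeBelow⇒⊆ sucΛ (OrdinalFunction.J-ord F β β-ord) (complete β β-ord β∈Λ))
        , (λ Λ≥J β β-ord β∈Λ γ γ∈J → regular γ (Λ≥J β β-ord β∈Λ γ γ∈J))
  where
  open Derived (BaseTheory.structure T)
  open Completeness T
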